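{- Let $v_1=(x_1,y_1)$ and $v_2=(x_2,y_2)$ be distinct points of $A_2$, and let $v_3=(x,y)\in A_2$. Then $d^{\rm hex}_3(v_1,v_2,v_3)=d^{\rm hex}(v_1,v_2)$ if and only if $\min\{x_1,x_2\}\le x\le\max\{x_1,x_2\}$, $\min\{y_1,y_2\}\le y\le\max\{y_1,y_2\}$, and $\min\{x_1-y_1,x_2-y_2\}\le x-y\le\max\{x_1-y_1,x_2-y_2\}$.
   Context: Let $\omega=-\tfrac12+\tfrac{\sqrt3}{2}i$. The hexagonal lattice is $A_2=\{x+\omega y: x,y\in\mathbb{Z}\}$, and the point $x+\omega y$ is written $(x,y)$. The hexagonal graph has vertex set $A_2$, two points being adjacent iff their Euclidean distance (in $\mathbb{C}$) is $1$; equivalently $(x,y)$ is adjacent to $(x\pm1,y)$, $(x,y\pm1)$, $(x+1,y+1)$, $(x-1,y-1)$. $d^{\rm hex}$ denotes graph distance and $d^{\rm hex}_3(v_1,v_2,v_3)$ the minimum number of edges of a tree in the hexagonal graph (possibly using additional vertices) containing $v_1,v_2,v_3$. -}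

module Defs where

open import Data.Integer using (ℤ; _+_; _-_; _≤_; _⊓_; _⊔_; 1ℤ; -1ℤ)
open import Data.Nat using (ℕ; zero; suc) renaming (_≤_ to _≤ℕ_)
open import Data.Product using (_×_; _,_; proj₁; proj₂)
open import Data.Sum using (_⊎_)
open import Data.Fin using (Fin)
open import Data.List using (List; length; lookup; removeAt)
open import Data.List.Membership.Propositional using (_∈_)
open import Relation.Nullary using (¬_)
open import Relation.Binary.PropositionalEquality using (_≡_)

-- A point x + ω y of A₂ is written (x , y).
Vtx : Set
Vtx = ℤ × ℤ

data Adj : Vtx → Vtx → Set where
  e+x  : ∀ {x y} → Adj (x , y) (x + 1ℤ , y)
  e-x  : ∀ {x y} → Adj (x , y) (x - 1ℤ , y)
  e+y  : ∀ {x y} → Adj (x , y) (x , y + 1ℤ)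
  e-y  : ∀ {x y} → Adj (x , y) (x , y - 1ℤ)
  e+xy : ∀ {x y} → Adj (x , y) (x + 1ℤ , y + 1ℤ)
  e-xy : ∀ {x y} → Adj (x , y) (x - 1ℤ , y - 1ℤ)

data HexWalk : Vtx → Vtx → ℕ → Set where
  here : ∀ {a} → HexWalk a a zero
  step : ∀ {a b c n} → Adj a b → HexWalk b c n → HexWalk a c (suc n)

HexDist : Vtx → Vtx → ℕ → Set
HexDist u v n = HexWalk u v n × (∀ m → HexWalk u v m → n ≤ℕ m)

data EWalk (F : List (Vtx × Vtx)) : Vtx → Vtx → Set where
  here : ∀ {a} → EWalk F a a
  step : ∀ {a b c} → ((a , b) ∈ F ⊎ (b , a) ∈ F) → EWalk F b c → EWalk F a c

record IsHexTree (V : List Vtx) (E : List (Vtx × Vtx)) : Set where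
  field
    edgesAdj   : ∀ {a b} → (a , b) ∈ E → Adj a b
    endpointsˡ : ∀ {a b} → (a , b) ∈ E → a ∈ V
    endpointsʳ : ∀ {a b} → (a , b) ∈ E → b ∈ V
    connected  : ∀ {a b} → a ∈ V → b ∈ V → EWalk E a b
    -- acyclic: every edge is a bridge (removing it disconnects its endpoints);
    -- in particular E lists each edge exactly once.
    acyclic    : (i : Fin (length E)) →
                 ¬ EWalk (removeAt E i) (proj₁ (lookup E i)) (proj₂ (lookup E i))

SteinerTree : Vtx → Vtx → Vtx → ℕ → Set
SteinerTree v₁ v₂ v₃ k =
  Data.Product.Σ (List Vtx) λ V → Data.Product.Σ (List (Vtx × Vtx)) λ E →
    IsHexTree V E × v₁ ∈ V × v₂ ∈ V × v₃ ∈ V × length E ≡ k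

HexDist3 : Vtx → Vtx → Vtx → ℕ → Set
HexDist3 v₁ v₂ v₃ n = SteinerTree v₁ v₂ v₃ n × (∀ k → SteinerTree v₁ v₂ v₃ k → n ≤ℕ k)

Between : ℤ → ℤ → ℤ → Set
Between a b t = (a ⊓ b) ≤ t × t ≤ (a ⊔ b)

-- Besides x and y use the third coordinate z = x - y.  Along an edge one of x, y, z
-- stays fixed and the other two change by one, so an edge crosses at most two of the
-- levels "coordinate between t and t + 1".  An edge set connecting v₁ and v₂ crosses
-- every level of every coordinate separating them, so it has at least D / 2 edges,
-- where D = |Δx| + |Δy| + |Δz|; straight walks of exactly D / 2 edges exist, and such a
-- walk is a tree.  Hence d^hex(v₁,v₂) = D / 2, and if v₃ lies between v₁ and v₂ in all
-- three coordinates, two such walks through v₃ form a tree with D / 2 edges.  If v₃ lies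
-- outside the range of one coordinate, a tree containing v₁, v₂, v₃ crosses one extra
-- level of that coordinate, so it has more than D / 2 edges.
module Submission where

open import Defs
open import Data.Empty using (⊥-elim)
open import Data.Fin using (Fin; toℕ)
open import Data.Fin.Properties using (toℕ<n; toℕ-injective; injective⇒≤)
open import Data.Integer
  using (ℤ; +_; ∣_∣; 1ℤ; -1ℤ; _+_; _-_; -_; _≤_; _<_; _⊓_; _⊔_; _≟_; _≤?_; +<+)
import Data.Integer.Properties as ℤₚ
open import Algebra.Properties.AbelianGroup ℤₚ.+-0-abelianGroup using (∙-cancelˡ)
open import Data.Integer.Tactic.RingSolver using (solve-∀)
open import Data.List using (List; []; _∷_; _++_; length; lookup; removeAt)
import Data.List.Properties as Listₚ
open import Data.List.Membership.Propositional using (_∈_)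
open import Data.List.Membership.Propositional.Properties using (∈-++⁺ˡ; ∈-++⁺ʳ)
open import Data.List.Relation.Unary.Any using (here; there; index)
open import Data.List.Relation.Unary.Any.Properties using (lookup-index)
open import Data.Nat as ℕ using (ℕ; zero; suc)
import Data.Nat.Properties as ℕₚ
import Data.Nat.Tactic.RingSolver as ℕ-Ring
open import Data.Product using (Σ; _×_; _,_; proj₁; proj₂)
open import Data.Sum using (_⊎_; inj₁; inj₂)
import Data.Sum as Sum
open import Function.Bundles using (_⇔_; mk⇔)
open import Relation.Binary.PropositionalEquality
open import Relation.Nullary using (¬_; Dec; yes; no)
open import Relation.Nullary.Decidable using (_×-dec_; decidable-stable)

u<u+1 : ∀ u → u < u + 1ℤ
u<u+1 u = ℤₚ.suc[i]≤j⇒i<j (ℤₚ.≤-reflexive (ℤₚ.+-comm 1ℤ u))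

<+1⇒≤ : ∀ {t u} → t < u + 1ℤ → t ≤ u
<+1⇒≤ {t} {u} t<u+1 = ℤₚ.≮⇒≥ λ u<t →
  ℤₚ.≤⇒≯ (subst (_≤ t) (ℤₚ.+-comm 1ℤ u) (ℤₚ.i<j⇒suc[i]≤j u<t)) t<u+1

⊓≤⇒ : ∀ {a b t} → a ⊓ b ≤ t → a ≤ t ⊎ b ≤ t
⊓≤⇒ {a} {b} m≤t = Sum.map (λ eq → subst (_≤ _) eq m≤t) (λ eq → subst (_≤ _) eq m≤t)
  (ℤₚ.⊓-sel a b)

<⊔⇒ : ∀ {a b t} → t < a ⊔ b → t < a ⊎ t < b
<⊔⇒ {a} {b} t<M = Sum.map (λ eq → subst (_ <_) eq t<M) (λ eq → subst (_ <_) eq t<M)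
  (ℤₚ.⊔-sel a b)

i≤j⇒i+∣i-j∣≡j : ∀ {i j} → i ≤ j → i + + ∣ i - j ∣ ≡ j
i≤j⇒i+∣i-j∣≡j {i} {j} i≤j = trans (cong (λ d → i + d) (ℤₚ.∣-∣-≤ i≤j)) (lemma i j)
  where
  lemma : ∀ i j → i + (j - i) ≡ j
  lemma = solve-∀

i≤j⇒j-∣i-j∣≡i : ∀ {i j} → i ≤ j → j - + ∣ i - j ∣ ≡ i
i≤j⇒j-∣i-j∣≡i {i} {j} i≤j = trans (cong (λ d → j - d) (ℤₚ.∣-∣-≤ i≤j)) (lemma i j)
  where
  lemma : ∀ i j → j - (j - i) ≡ i
  lemma = solve-∀

⊓+∣-∣≡⊔ : ∀ a b → a ⊓ b + + ∣ a - b ∣ ≡ a ⊔ b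
⊓+∣-∣≡⊔ a b with ℤₚ.≤-total a b
... | inj₁ a≤b = begin
  a ⊓ b + + ∣ a - b ∣ ≡⟨ cong (_+ + ∣ a - b ∣) (ℤₚ.i≤j⇒i⊓j≡i a≤b) ⟩
  a + + ∣ a - b ∣     ≡⟨ i≤j⇒i+∣i-j∣≡j a≤b ⟩
  b                   ≡⟨ ℤₚ.i≤j⇒i⊔j≡j a≤b ⟨
  a ⊔ b               ∎
  where open ≡-Reasoning
... | inj₂ b≤a = begin
  a ⊓ b + + ∣ a - b ∣ ≡⟨ cong₂ (λ m d → m + + d) (ℤₚ.i≥j⇒i⊓j≡j b≤a) (ℤₚ.∣i-j∣≡∣j-i∣ a b) ⟩
  b + + ∣ b - a ∣     ≡⟨ i≤j⇒i+∣i-j∣≡j b≤a ⟩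
  a                   ≡⟨ ℤₚ.i≥j⇒i⊔j≡i b≤a ⟨
  a ⊔ b               ∎
  where open ≡-Reasoning

∣i-[i+j]∣≡∣j∣ : ∀ i j → ∣ i - (i + j) ∣ ≡ ∣ j ∣
∣i-[i+j]∣≡∣j∣ i j = trans (cong ∣_∣ (lemma i j)) (ℤₚ.∣-i∣≡∣i∣ j)
  where
  lemma : ∀ i j → i - (i + j) ≡ - j
  lemma = solve-∀

∣[i+j]-i∣≡∣j∣ : ∀ i j → ∣ (i + j) - i ∣ ≡ ∣ j ∣
∣[i+j]-i∣≡∣j∣ i j = cong ∣_∣ (lemma i j)
  where
  lemma : ∀ i j → (i + j) - i ≡ j
  lemma = solve-∀

∣i-j∣+∣j-k∣≡∣i-k∣ : ∀ {i j k} → i ≤ j → j ≤ k → ∣ i - j ∣ ℕ.+ ∣ j - k ∣ ≡ ∣ i - k ∣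
∣i-j∣+∣j-k∣≡∣i-k∣ {i} {j} {k} i≤j j≤k = ℤₚ.+-injective (begin
  + ∣ i - j ∣ + + ∣ j - k ∣ ≡⟨ cong₂ _+_ (ℤₚ.∣-∣-≤ i≤j) (ℤₚ.∣-∣-≤ j≤k) ⟩
  (j - i) + (k - j)         ≡⟨ lemma i j k ⟩
  k - i                     ≡⟨ ℤₚ.∣-∣-≤ (ℤₚ.≤-trans i≤j j≤k) ⟨
  + ∣ i - k ∣               ∎)
  where
  open ≡-Reasoning
  lemma : ∀ i j k → (j - i) + (k - j) ≡ k - i
  lemma = solve-∀

∣-∣-between : ∀ {a b c} → Between a b c → ∣ a - c ∣ ℕ.+ ∣ c - b ∣ ≡ ∣ a - b ∣
∣-∣-between {a} {b} {c} (m≤c , c≤M) with ℤₚ.≤-total a b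
... | inj₁ a≤b = ∣i-j∣+∣j-k∣≡∣i-k∣ (subst (_≤ c) (ℤₚ.i≤j⇒i⊓j≡i a≤b) m≤c)
                                   (subst (c ≤_) (ℤₚ.i≤j⇒i⊔j≡j a≤b) c≤M)
... | inj₂ b≤a = begin
  ∣ a - c ∣ ℕ.+ ∣ c - b ∣ ≡⟨ ℕₚ.+-comm ∣ a - c ∣ ∣ c - b ∣ ⟩
  ∣ c - b ∣ ℕ.+ ∣ a - c ∣ ≡⟨ cong₂ ℕ._+_ (ℤₚ.∣i-j∣≡∣j-i∣ c b) (ℤₚ.∣i-j∣≡∣j-i∣ a c) ⟩
  ∣ b - c ∣ ℕ.+ ∣ c - a ∣ ≡⟨ ∣i-j∣+∣j-k∣≡∣i-k∣ (subst (_≤ c) (ℤₚ.i≥j⇒i⊓j≡j b≤a) m≤c)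
                                              (subst (c ≤_) (ℤₚ.i≥j⇒i⊔j≡i b≤a) c≤M) ⟩
  ∣ b - a ∣               ≡⟨ ℤₚ.∣i-j∣≡∣j-i∣ b a ⟩
  ∣ a - b ∣               ∎
  where open ≡-Reasoning

-- The positions in L of lo, …, lo + k - 1 are pairwise distinct.
interval⊆⇒≤length : ∀ {L : List ℤ} {lo k} →
                    (∀ {t} → lo ≤ t → t < lo + + k → t ∈ L) → k ℕ.≤ length L
interval⊆⇒≤length {L} {lo} {k} covers = injective⇒≤ {f = position} position-injective
  where
  member : ∀ (i : Fin k) → lo + + toℕ i ∈ L
  member i = covers (ℤₚ.i≤i+j lo (+ toℕ i)) (ℤₚ.+-monoʳ-< lo (+<+ (toℕ<n i)))
  position : Fin k → Fin (length L)
  position i = index (member i)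
  position-injective : ∀ {i j} → position i ≡ position j → i ≡ j
  position-injective {i} {j} eq = toℕ-injective (ℤₚ.+-injective (∙-cancelˡ lo _ _ (begin
    lo + + toℕ i            ≡⟨ lookup-index (member i) ⟩
    lookup L (position i)   ≡⟨ cong (lookup L) eq ⟩
    lookup L (position j)   ≡⟨ lookup-index (member j) ⟨
    lo + + toℕ j            ∎)))
    where open ≡-Reasoning

data Axis : Set where
  x-axis y-axis z-axis : Axis

coord : Axis → Vtx → ℤ
coord x-axis (x , y) = x
coord y-axis (x , y) = y
coord z-axis (x , y) = x - y

BetweenOn : Axis → Vtx → Vtx → Vtx → Set
BetweenOn α v₁ v₂ v₃ = Between (coord α v₁) (coord α v₂) (coord α v₃)

between? : ∀ α v₁ v₂ v₃ → Dec (BetweenOn α v₁ v₂ v₃)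
between? α v₁ v₂ v₃ = (_ ≤? _) ×-dec (_ ≤? _)

data Near (u v : ℤ) : Set where
  same : v ≡ u → Near u v
  up   : v ≡ u + 1ℤ → Near u v
  down : u ≡ v + 1ℤ → Near u v

i≡[i-1]+1 : ∀ i → i ≡ (i - 1ℤ) + 1ℤ
i≡[i-1]+1 = solve-∀

[i+1]-[j+1]≡i-j : ∀ i j → (i + 1ℤ) - (j + 1ℤ) ≡ i - j
[i+1]-[j+1]≡i-j = solve-∀

[i-1]-[j-1]≡i-j : ∀ i j → (i - 1ℤ) - (j - 1ℤ) ≡ i - j
[i-1]-[j-1]≡i-j = solve-∀

adj-near : ∀ {a b} → Adj a b → ∀ α → Near (coord α a) (coord α b)
adj-near e+x            x-axis = up refl
adj-near e+x            y-axis = same refl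
adj-near (e+x {x} {y})  z-axis = up (lemma x y)
  where lemma : ∀ x y → (x + 1ℤ) - y ≡ (x - y) + 1ℤ
        lemma = solve-∀
adj-near (e-x {x})      x-axis = down (i≡[i-1]+1 x)
adj-near e-x            y-axis = same refl
adj-near (e-x {x} {y})  z-axis = down (lemma x y)
  where lemma : ∀ x y → x - y ≡ ((x - 1ℤ) - y) + 1ℤ
        lemma = solve-∀
adj-near e+y            x-axis = same refl
adj-near e+y            y-axis = up refl
adj-near (e+y {x} {y})  z-axis = down (lemma x y)
  where lemma : ∀ x y → x - y ≡ (x - (y + 1ℤ)) + 1ℤ
        lemma = solve-∀
adj-near e-y            x-axis = same refl
adj-near (e-y {y = y})  y-axis = down (i≡[i-1]+1 y)
adj-near (e-y {x} {y})  z-axis = up (lemma x y)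
  where lemma : ∀ x y → x - (y - 1ℤ) ≡ (x - y) + 1ℤ
        lemma = solve-∀
adj-near e+xy           x-axis = up refl
adj-near e+xy           y-axis = up refl
adj-near (e+xy {x} {y}) z-axis = same ([i+1]-[j+1]≡i-j x y)
adj-near (e-xy {x})     x-axis = down (i≡[i-1]+1 x)
adj-near (e-xy {y = y}) y-axis = down (i≡[i-1]+1 y)
adj-near (e-xy {x} {y}) z-axis = same ([i-1]-[j-1]≡i-j x y)

adj-flat : ∀ {a b} → Adj a b → Σ Axis λ α → coord α a ≡ coord α b
adj-flat e+x            = y-axis , refl
adj-flat e-x            = y-axis , refl
adj-flat e+y            = x-axis , refl
adj-flat e-y            = x-axis , refl
adj-flat (e+xy {x} {y}) = z-axis , sym ([i+1]-[j+1]≡i-j x y)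
adj-flat (e-xy {x} {y}) = z-axis , sym ([i-1]-[j-1]≡i-j x y)

-- Level t separates t from t + 1, so an edge along which a coordinate takes the values
-- u and v = u ± 1 crosses level u ⊓ v.
crossing : ℤ → ℤ → List ℤ
crossing u v with u ≟ v
... | yes _ = []
... | no _  = u ⊓ v ∷ []

length-crossing≤1 : ∀ u v → length (crossing u v) ℕ.≤ 1
length-crossing≤1 u v with u ≟ v
... | yes _ = ℕ.z≤n
... | no _  = ℕ.s≤s ℕ.z≤n

crossing-flat : ∀ {u v} → u ≡ v → length (crossing u v) ≡ 0
crossing-flat {u} refl with u ≟ u
... | yes _  = refl
... | no u≢u = ⊥-elim (u≢u refl)

unit-step-level : ∀ {u t} → u ⊓ (u + 1ℤ) ≤ t → t < u ⊔ (u + 1ℤ) → t ≡ u ⊓ (u + 1ℤ)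
unit-step-level {u} {t} lo hi =
  trans (ℤₚ.≤-antisym (<+1⇒≤ (subst (t <_) max≡ hi)) (subst (_≤ t) min≡ lo)) (sym min≡)
  where
  u≤u+1 = ℤₚ.<⇒≤ (u<u+1 u)
  min≡ = ℤₚ.i≤j⇒i⊓j≡i u≤u+1
  max≡ = ℤₚ.i≤j⇒i⊔j≡j u≤u+1

crosses : ∀ {u v t} → Near u v → u ⊓ v ≤ t → t < u ⊔ v → t ∈ crossing u v
crosses {u} (same refl) lo hi =
  ⊥-elim (ℤₚ.≤⇒≯ (subst (_≤ _) (ℤₚ.⊓-idem u) lo) (subst (_ <_) (ℤₚ.⊔-idem u) hi))
crosses {u} (up refl) lo hi with u ≟ u + 1ℤ
... | yes u≡u+1 = ⊥-elim (ℤₚ.<-irrefl u≡u+1 (u<u+1 u))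
... | no _      = here (unit-step-level lo hi)
crosses {v = v} (down refl) lo hi with v + 1ℤ ≟ v
... | yes v+1≡v = ⊥-elim (ℤₚ.<-irrefl (sym v+1≡v) (u<u+1 v))
... | no _      = here (trans (unit-step-level (subst (_≤ _) (ℤₚ.⊓-comm (v + 1ℤ) v) lo)
                                               (subst (_ <_) (ℤₚ.⊔-comm (v + 1ℤ) v) hi))
                              (ℤₚ.⊓-comm v (v + 1ℤ)))

sumAxes : (Axis → ℕ) → ℕ
sumAxes f = f x-axis ℕ.+ f y-axis ℕ.+ f z-axis

sumAxes-cong : ∀ {f g} → (∀ α → f α ≡ g α) → sumAxes f ≡ sumAxes g
sumAxes-cong f≡g = cong₂ ℕ._+_ (cong₂ ℕ._+_ (f≡g x-axis) (f≡g y-axis)) (f≡g z-axis)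

sumAxes-+ : ∀ f g → sumAxes (λ α → f α ℕ.+ g α) ≡ sumAxes f ℕ.+ sumAxes g
sumAxes-+ f g = lemma (f x-axis) (f y-axis) (f z-axis) (g x-axis) (g y-axis) (g z-axis)
  where
  lemma : ∀ a b c d e f → a ℕ.+ d ℕ.+ (b ℕ.+ e) ℕ.+ (c ℕ.+ f) ≡ a ℕ.+ b ℕ.+ c ℕ.+ (d ℕ.+ e ℕ.+ f)
  lemma = ℕ-Ring.solve-∀

sumAxes-mono-≤ : ∀ {f g} → (∀ α → f α ℕ.≤ g α) → sumAxes f ℕ.≤ sumAxes g
sumAxes-mono-≤ f≤g = ℕₚ.+-mono-≤ (ℕₚ.+-mono-≤ (f≤g x-axis) (f≤g y-axis)) (f≤g z-axis)

sumAxes-mono-< : ∀ {f g} α → (∀ β → f β ℕ.≤ g β) → f α ℕ.< g α → sumAxes f ℕ.< sumAxes g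
sumAxes-mono-< x-axis f≤g f<g = ℕₚ.+-mono-<-≤ (ℕₚ.+-mono-<-≤ f<g (f≤g y-axis)) (f≤g z-axis)
sumAxes-mono-< y-axis f≤g f<g = ℕₚ.+-mono-<-≤ (ℕₚ.+-mono-≤-< (f≤g x-axis) f<g) (f≤g z-axis)
sumAxes-mono-< z-axis f≤g f<g = ℕₚ.+-mono-≤-< (ℕₚ.+-mono-≤ (f≤g x-axis) (f≤g y-axis)) f<g

sumAxes-≤2 : ∀ {f} α → (∀ β → f β ℕ.≤ 1) → f α ≡ 0 → sumAxes f ℕ.≤ 2
sumAxes-≤2 x-axis ≤1 f≡0 = ℕₚ.+-mono-≤ (ℕₚ.+-mono-≤ (ℕₚ.≤-reflexive f≡0) (≤1 y-axis)) (≤1 z-axis)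
sumAxes-≤2 y-axis ≤1 f≡0 = ℕₚ.+-mono-≤ (ℕₚ.+-mono-≤ (≤1 x-axis) (ℕₚ.≤-reflexive f≡0)) (≤1 z-axis)
sumAxes-≤2 z-axis ≤1 f≡0 = ℕₚ.+-mono-≤ (ℕₚ.+-mono-≤ (≤1 x-axis) (≤1 y-axis)) (ℕₚ.≤-reflexive f≡0)

edge-crossings≤2 : ∀ {a b} → Adj a b →
                   sumAxes (λ α → length (crossing (coord α a) (coord α b))) ℕ.≤ 2
edge-crossings≤2 {a} {b} ab with adj-flat ab
... | α , flat = sumAxes-≤2 {λ β → length (crossing (coord β a) (coord β b))} α
                   (λ β → length-crossing≤1 (coord β a) (coord β b)) (crossing-flat flat)

AllAdj : List (Vtx × Vtx) → Set
AllAdj E = ∀ {a b} → (a , b) ∈ E → Adj a b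

levels : Axis → List (Vtx × Vtx) → List ℤ
levels α []            = []
levels α ((a , b) ∷ E) = crossing (coord α a) (coord α b) ++ levels α E

∈-levels : ∀ {E a b t} α → (a , b) ∈ E → t ∈ crossing (coord α a) (coord α b) → t ∈ levels α E
∈-levels {_ ∷ _}       α (here refl) t∈ = ∈-++⁺ˡ t∈
∈-levels {(a , b) ∷ _} α (there e∈)  t∈ =
  ∈-++⁺ʳ (crossing (coord α a) (coord α b)) (∈-levels α e∈ t∈)

levels-count : ∀ {E} → AllAdj E → sumAxes (λ α → length (levels α E)) ℕ.≤ 2 ℕ.* length E
levels-count {[]}          _   = ℕ.z≤n
levels-count {(a , b) ∷ E} adj = begin
  sumAxes (λ α → length (levels α ((a , b) ∷ E)))
    ≡⟨ sumAxes-cong (λ α → Listₚ.length-++ (edge α) {levels α E}) ⟩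
  sumAxes (λ α → length (edge α) ℕ.+ length (levels α E))
    ≡⟨ sumAxes-+ (λ α → length (edge α)) (λ α → length (levels α E)) ⟩
  sumAxes (λ α → length (edge α)) ℕ.+ sumAxes (λ α → length (levels α E))
    ≤⟨ ℕₚ.+-mono-≤ (edge-crossings≤2 (adj (here refl))) (levels-count (λ e∈ → adj (there e∈))) ⟩
  2 ℕ.+ 2 ℕ.* length E
    ≡⟨ ℕₚ.*-suc 2 (length E) ⟨
  2 ℕ.* suc (length E) ∎
  where
  open ℕₚ.≤-Reasoning
  edge : Axis → List ℤ
  edge α = crossing (coord α a) (coord α b)

_++ᵉ_ : ∀ {F a b c} → EWalk F a b → EWalk F b c → EWalk F a c
here     ++ᵉ w′ = w′
step e w ++ᵉ w′ = step e (w ++ᵉ w′)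

reverseᵉ : ∀ {F a b} → EWalk F a b → EWalk F b a
reverseᵉ here       = here
reverseᵉ (step e w) = reverseᵉ w ++ᵉ step (Sum.swap e) here

mapᵉ : ∀ {F G a b} → (∀ {e} → e ∈ F → e ∈ G) → EWalk F a b → EWalk G a b
mapᵉ F⊆G here       = here
mapᵉ F⊆G (step e w) = step (Sum.map F⊆G F⊆G e) (mapᵉ F⊆G w)

walk-crosses : ∀ {E p q t} α → AllAdj E → EWalk E p q →
               coord α p ≤ t → t < coord α q → t ∈ levels α E
walk-crosses α adj here p≤t t<p = ⊥-elim (ℤₚ.≤⇒≯ p≤t t<p)
walk-crosses {E} {t = t} α adj (step {a} {b} e w) a≤t t<q with coord α b ≤? t
... | yes b≤t = walk-crosses α adj w b≤t t<q
... | no b≰t  = crosses-edge e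
  where
  t<b : t < coord α b
  t<b = ℤₚ.≰⇒> b≰t
  crosses-edge : (a , b) ∈ E ⊎ (b , a) ∈ E → t ∈ levels α E
  crosses-edge (inj₁ ab∈E) = ∈-levels α ab∈E (crosses (adj-near (adj ab∈E) α)
    (ℤₚ.i≤j⇒i⊓k≤j _ a≤t) (ℤₚ.<-≤-trans t<b (ℤₚ.i≤j⊔i _ _)))
  crosses-edge (inj₂ ba∈E) = ∈-levels α ba∈E (crosses (adj-near (adj ba∈E) α)
    (ℤₚ.i≤j⇒k⊓i≤j _ a≤t) (ℤₚ.<-≤-trans t<b (ℤₚ.i≤i⊔j _ _)))

walk-covers : ∀ {E u w t} α → AllAdj E → EWalk E u w →
              coord α u ⊓ coord α w ≤ t → t < coord α u ⊔ coord α w → t ∈ levels α E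
walk-covers α adj w lo hi with ⊓≤⇒ lo | <⊔⇒ hi
... | inj₁ u≤t | inj₂ t<w = walk-crosses α adj w u≤t t<w
... | inj₂ w≤t | inj₁ t<u = walk-crosses α adj (reverseᵉ w) w≤t t<u
... | inj₁ u≤t | inj₁ t<u = ⊥-elim (ℤₚ.≤⇒≯ u≤t t<u)
... | inj₂ w≤t | inj₂ t<w = ⊥-elim (ℤₚ.≤⇒≯ w≤t t<w)

walk-levels : ∀ {E u w} α → AllAdj E → EWalk E u w →
              ∣ coord α u - coord α w ∣ ℕ.≤ length (levels α E)
walk-levels {u = u} {w} α adj walk = interval⊆⇒≤length λ lo≤t t<hi →
  walk-covers α adj walk lo≤t (subst (_ <_) (⊓+∣-∣≡⊔ (coord α u) (coord α w)) t<hi)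

levels-below-v₃ : ∀ {E v₁ v₂ v₃ t} α → AllAdj E → EWalk E v₁ v₃ → EWalk E v₂ v₃ →
                  coord α v₁ ⊓ coord α v₂ ≤ t → t < coord α v₃ → t ∈ levels α E
levels-below-v₃ α adj w₁ w₂ m≤t t<c with ⊓≤⇒ m≤t
... | inj₁ a≤t = walk-crosses α adj w₁ a≤t t<c
... | inj₂ b≤t = walk-crosses α adj w₂ b≤t t<c

levels-above-v₃ : ∀ {E v₁ v₂ v₃ t} α → AllAdj E → EWalk E v₁ v₃ → EWalk E v₂ v₃ →
                  coord α v₃ ≤ t → t < coord α v₁ ⊔ coord α v₂ → t ∈ levels α E
levels-above-v₃ α adj w₁ w₂ c≤t t<M with <⊔⇒ t<M
... | inj₁ t<a = walk-crosses α adj (reverseᵉ w₁) c≤t t<a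
... | inj₂ t<b = walk-crosses α adj (reverseᵉ w₂) c≤t t<b

-- The crossed levels are those of the range of v₁ and v₂ together with the one just above it.
v₃-above-range-levels : ∀ {E v₁ v₂ v₃} α → AllAdj E → EWalk E v₁ v₃ → EWalk E v₂ v₃ →
                        coord α v₁ ⊔ coord α v₂ < coord α v₃ →
                        suc ∣ coord α v₁ - coord α v₂ ∣ ℕ.≤ length (levels α E)
v₃-above-range-levels {v₁ = v₁} {v₂} α adj w₁ w₂ M<c =
  interval⊆⇒≤length {lo = a ⊓ b} λ {t} m≤t t<M+1 →
    levels-below-v₃ α adj w₁ w₂ m≤t (ℤₚ.≤-<-trans (<+1⇒≤ (subst (t <_) M+1 t<M+1)) M<c)
  where
  a = coord α v₁
  b = coord α v₂
  M+1 : a ⊓ b + + suc ∣ a - b ∣ ≡ a ⊔ b + 1ℤ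
  M+1 = trans (lemma (a ⊓ b) (+ ∣ a - b ∣)) (cong (_+ 1ℤ) (⊓+∣-∣≡⊔ a b))
    where lemma : ∀ i j → i + (1ℤ + j) ≡ (i + j) + 1ℤ
          lemma = solve-∀

-- The crossed levels are those of the range of v₁ and v₂ together with the one just below it.
v₃-below-range-levels : ∀ {E v₁ v₂ v₃} α → AllAdj E → EWalk E v₁ v₃ → EWalk E v₂ v₃ →
                        coord α v₃ < coord α v₁ ⊓ coord α v₂ →
                        suc ∣ coord α v₁ - coord α v₂ ∣ ℕ.≤ length (levels α E)
v₃-below-range-levels {v₁ = v₁} {v₂} α adj w₁ w₂ c<m =
  interval⊆⇒≤length {lo = -1ℤ + a ⊓ b} λ {t} lo≤t t<M →
    levels-above-v₃ α adj w₁ w₂ (ℤₚ.≤-trans (ℤₚ.i<j⇒i≤pred[j] c<m) lo≤t) (subst (t <_) M≡ t<M)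
  where
  a = coord α v₁
  b = coord α v₂
  M≡ : (-1ℤ + a ⊓ b) + + suc ∣ a - b ∣ ≡ a ⊔ b
  M≡ = trans (lemma (a ⊓ b) (+ ∣ a - b ∣)) (⊓+∣-∣≡⊔ a b)
    where lemma : ∀ i j → (-1ℤ + i) + (1ℤ + j) ≡ i + j
          lemma = solve-∀

detour-levels : ∀ {E v₁ v₂ v₃} α → AllAdj E → EWalk E v₁ v₃ → EWalk E v₂ v₃ →
                ¬ BetweenOn α v₁ v₂ v₃ → suc ∣ coord α v₁ - coord α v₂ ∣ ℕ.≤ length (levels α E)
detour-levels {v₁ = v₁} {v₂} {v₃} α adj w₁ w₂ outside
  with coord α v₁ ⊓ coord α v₂ ≤? coord α v₃
... | yes m≤c = v₃-above-range-levels α adj w₁ w₂ (ℤₚ.≰⇒> λ c≤M → outside (m≤c , c≤M))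
... | no m≰c  = v₃-below-range-levels α adj w₁ w₂ (ℤₚ.≰⇒> m≰c)

-- Twice the hexagonal distance (hexDist-coordDist).
coordDist : Vtx → Vtx → ℕ
coordDist u w = sumAxes λ α → ∣ coord α u - coord α w ∣

coordDist-comm : ∀ u w → coordDist u w ≡ coordDist w u
coordDist-comm u w = sumAxes-cong λ α → ℤₚ.∣i-j∣≡∣j-i∣ (coord α u) (coord α w)

coordDist-between : ∀ {v₁ v₂ v₃} → (∀ α → BetweenOn α v₁ v₂ v₃) →
                    coordDist v₁ v₃ ℕ.+ coordDist v₃ v₂ ≡ coordDist v₁ v₂
coordDist-between {v₁} {v₂} {v₃} between =
  trans (sym (sumAxes-+ (λ α → ∣ coord α v₁ - coord α v₃ ∣) (λ α → ∣ coord α v₃ - coord α v₂ ∣)))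
        (sumAxes-cong λ α → ∣-∣-between (between α))

coordDist-offset : ∀ x y i j → coordDist (x , y) (x + i , y + j) ≡ ∣ i ∣ ℕ.+ ∣ j ∣ ℕ.+ ∣ i - j ∣
coordDist-offset x y i j =
  cong₂ ℕ._+_ (cong₂ ℕ._+_ (∣i-[i+j]∣≡∣j∣ x i) (∣i-[i+j]∣≡∣j∣ y j))
              (trans (cong ∣_∣ (lemma x y i j)) (∣i-[i+j]∣≡∣j∣ (x - y) (i - j)))
  where
  lemma : ∀ x y i j → (x - y) - ((x + i) - (y + j)) ≡ (x - y) - ((x - y) + (i - j))
  lemma = solve-∀

coordDist≤2*length : ∀ {E u w} → AllAdj E → EWalk E u w → coordDist u w ℕ.≤ 2 ℕ.* length E
coordDist≤2*length adj walk =
  ℕₚ.≤-trans (sumAxes-mono-≤ λ α → walk-levels α adj walk) (levels-count adj)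

coordDist<2*length : ∀ {E v₁ v₂ v₃} α → AllAdj E →
                     EWalk E v₁ v₂ → EWalk E v₁ v₃ → EWalk E v₂ v₃ → ¬ BetweenOn α v₁ v₂ v₃ →
                     coordDist v₁ v₂ ℕ.< 2 ℕ.* length E
coordDist<2*length α adj w₁₂ w₁₃ w₂₃ outside = ℕₚ.<-≤-trans
  (sumAxes-mono-< α (λ β → walk-levels β adj w₁₂) (detour-levels α adj w₁₃ w₂₃ outside))
  (levels-count adj)

retarget : ∀ {a b c k} → b ≡ c → HexWalk a b k → HexWalk a c k
retarget refl w = w

_++ʰ_ : ∀ {a b c k l} → HexWalk a b k → HexWalk b c l → HexWalk a c (k ℕ.+ l)
here     ++ʰ w′ = w′
step s w ++ʰ w′ = step s (w ++ʰ w′)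

[i+1]-1≡i : ∀ i → (i + 1ℤ) - 1ℤ ≡ i
[i+1]-1≡i = solve-∀

adj-sym : ∀ {a b} → Adj a b → Adj b a
adj-sym (e+x {x} {y})  = subst (λ x′ → Adj (x + 1ℤ , y) (x′ , y)) ([i+1]-1≡i x) e-x
adj-sym (e-x {x} {y})  = subst (λ x′ → Adj (x - 1ℤ , y) (x′ , y)) (sym (i≡[i-1]+1 x)) e+x
adj-sym (e+y {x} {y})  = subst (λ y′ → Adj (x , y + 1ℤ) (x , y′)) ([i+1]-1≡i y) e-y
adj-sym (e-y {x} {y})  = subst (λ y′ → Adj (x , y - 1ℤ) (x , y′)) (sym (i≡[i-1]+1 y)) e+y
adj-sym (e+xy {x} {y}) = subst₂ (λ x′ y′ → Adj (x + 1ℤ , y + 1ℤ) (x′ , y′))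
                                ([i+1]-1≡i x) ([i+1]-1≡i y) e-xy
adj-sym (e-xy {x} {y}) = subst₂ (λ x′ y′ → Adj (x - 1ℤ , y - 1ℤ) (x′ , y′))
                                (sym (i≡[i-1]+1 x)) (sym (i≡[i-1]+1 y)) e+xy

reverseʰ : ∀ {a b k} → HexWalk a b k → HexWalk b a k
reverseʰ here                 = here
reverseʰ {k = suc k} (step s w) =
  subst (HexWalk _ _) (ℕₚ.+-comm k 1) (reverseʰ w ++ʰ step (adj-sym s) here)

i≡i+0 : ∀ i → i ≡ i + + 0
i≡i+0 i = sym (ℤₚ.+-identityʳ i)

[i+1]+j≡i+[1+j] : ∀ i j → (i + 1ℤ) + j ≡ i + (1ℤ + j)
[i+1]+j≡i+[1+j] i j = ℤₚ.+-assoc i 1ℤ j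

[i-1]-j≡i-[1+j] : ∀ i j → (i - 1ℤ) - j ≡ i - (1ℤ + j)
[i-1]-j≡i-[1+j] = solve-∀

rightward : ∀ k {x y} → HexWalk (x , y) (x + + k , y) k
rightward zero    {x} = retarget (cong (_, _) (i≡i+0 x)) here
rightward (suc k) {x} = step e+x (retarget (cong (_, _) ([i+1]+j≡i+[1+j] x (+ k))) (rightward k))

upward : ∀ k {x y} → HexWalk (x , y) (x , y + + k) k
upward zero    {y = y} = retarget (cong (_ ,_) (i≡i+0 y)) here
upward (suc k) {y = y} = step e+y (retarget (cong (_ ,_) ([i+1]+j≡i+[1+j] y (+ k))) (upward k))

downward : ∀ k {x y} → HexWalk (x , y) (x , y - + k) k
downward zero    {y = y} = retarget (cong (_ ,_) (i≡i+0 y)) here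
downward (suc k) {y = y} = step e-y (retarget (cong (_ ,_) ([i-1]-j≡i-[1+j] y (+ k))) (downward k))

diagonal : ∀ k {x y} → HexWalk (x , y) (x + + k , y + + k) k
diagonal zero    {x} {y} = retarget (cong₂ _,_ (i≡i+0 x) (i≡i+0 y)) here
diagonal (suc k) {x} {y} = step e+xy
  (retarget (cong₂ _,_ ([i+1]+j≡i+[1+j] x (+ k)) ([i+1]+j≡i+[1+j] y (+ k))) (diagonal k))

Geodesic : Vtx → Vtx → Set
Geodesic u w = Σ ℕ λ k → HexWalk u w k × 2 ℕ.* k ≡ coordDist u w

geodesic-reverse : ∀ {u w} → Geodesic w u → Geodesic u w
geodesic-reverse {u} {w} (k , walk , 2k≡d) = k , reverseʰ walk , trans 2k≡d (coordDist-comm w u)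

diagonal-then-up : ∀ a d {x y} → Geodesic (x , y) (x + + a , y + + (a ℕ.+ d))
diagonal-then-up a d {x} {y} =
  a ℕ.+ d ,
  retarget (cong (_ ,_) (ℤₚ.+-assoc y (+ a) (+ d))) (diagonal a ++ʰ upward d) ,
  (begin
    2 ℕ.* (a ℕ.+ d)                         ≡⟨ lemma a d ⟩
    a ℕ.+ (a ℕ.+ d) ℕ.+ d                   ≡⟨ cong (a ℕ.+ (a ℕ.+ d) ℕ.+_) (∣i-[i+j]∣≡∣j∣ (+ a) (+ d)) ⟨
    a ℕ.+ (a ℕ.+ d) ℕ.+ ∣ + a - + (a ℕ.+ d) ∣ ≡⟨ coordDist-offset x y (+ a) (+ (a ℕ.+ d)) ⟨
    coordDist (x , y) (x + + a , y + + (a ℕ.+ d)) ∎)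
  where
  open ≡-Reasoning
  lemma : ∀ a d → 2 ℕ.* (a ℕ.+ d) ≡ a ℕ.+ (a ℕ.+ d) ℕ.+ d
  lemma = ℕ-Ring.solve-∀

diagonal-then-right : ∀ a d {x y} → Geodesic (x , y) (x + + (a ℕ.+ d) , y + + a)
diagonal-then-right a d {x} {y} =
  a ℕ.+ d ,
  retarget (cong (_, _) (ℤₚ.+-assoc x (+ a) (+ d))) (diagonal a ++ʰ rightward d) ,
  (begin
    2 ℕ.* (a ℕ.+ d)                         ≡⟨ lemma a d ⟩
    a ℕ.+ d ℕ.+ a ℕ.+ d                     ≡⟨ cong (a ℕ.+ d ℕ.+ a ℕ.+_) (∣[i+j]-i∣≡∣j∣ (+ a) (+ d)) ⟨
    a ℕ.+ d ℕ.+ a ℕ.+ ∣ + (a ℕ.+ d) - + a ∣ ≡⟨ coordDist-offset x y (+ (a ℕ.+ d)) (+ a) ⟨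
    coordDist (x , y) (x + + (a ℕ.+ d) , y + + a) ∎)
  where
  open ≡-Reasoning
  lemma : ∀ a d → 2 ℕ.* (a ℕ.+ d) ≡ a ℕ.+ d ℕ.+ a ℕ.+ d
  lemma = ℕ-Ring.solve-∀

right-then-down : ∀ a b {x y} → Geodesic (x , y) (x + + a , y - + b)
right-then-down a b {x} {y} =
  a ℕ.+ b ,
  rightward a ++ʰ downward b ,
  (begin
    2 ℕ.* (a ℕ.+ b)                            ≡⟨ lemma a b ⟩
    a ℕ.+ b ℕ.+ ∣ + a + + b ∣                  ≡⟨ cong₂ (λ n i → a ℕ.+ n ℕ.+ ∣ + a + i ∣)
                                                     (ℤₚ.∣-i∣≡∣i∣ (+ b)) (ℤₚ.neg-involutive (+ b)) ⟨
    a ℕ.+ ∣ - + b ∣ ℕ.+ ∣ + a - - + b ∣        ≡⟨ coordDist-offset x y (+ a) (- + b) ⟨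
    coordDist (x , y) (x + + a , y - + b)      ∎)
  where
  open ≡-Reasoning
  lemma : ∀ a b → 2 ℕ.* (a ℕ.+ b) ≡ a ℕ.+ b ℕ.+ (a ℕ.+ b)
  lemma = ℕ-Ring.solve-∀

geodesic-ascending : ∀ a b {x y} → Geodesic (x , y) (x + + a , y + + b)
geodesic-ascending a b {x} {y} with ℕₚ.≤-total a b
... | inj₁ a≤b = subst (λ b′ → Geodesic (x , y) (x + + a , y + + b′)) (ℕₚ.m+[n∸m]≡n a≤b)
                       (diagonal-then-up a (b ℕ.∸ a))
... | inj₂ b≤a = subst (λ a′ → Geodesic (x , y) (x + + a′ , y + + b)) (ℕₚ.m+[n∸m]≡n b≤a)
                       (diagonal-then-right b (a ℕ.∸ b))

geodesic-rightward : ∀ {x₁ y₁ x₂ y₂} → x₁ ≤ x₂ → Geodesic (x₁ , y₁) (x₂ , y₂)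
geodesic-rightward {x₁} {y₁} {x₂} {y₂} x₁≤x₂ with ℤₚ.≤-total y₁ y₂
... | inj₁ y₁≤y₂ = subst (Geodesic (x₁ , y₁))
                         (cong₂ _,_ (i≤j⇒i+∣i-j∣≡j x₁≤x₂) (i≤j⇒i+∣i-j∣≡j y₁≤y₂))
                         (geodesic-ascending ∣ x₁ - x₂ ∣ ∣ y₁ - y₂ ∣)
... | inj₂ y₂≤y₁ = subst (Geodesic (x₁ , y₁))
                         (cong₂ _,_ (i≤j⇒i+∣i-j∣≡j x₁≤x₂) (i≤j⇒j-∣i-j∣≡i y₂≤y₁))
                         (right-then-down ∣ x₁ - x₂ ∣ ∣ y₂ - y₁ ∣)

geodesic : ∀ u w → Geodesic u w
geodesic (x₁ , _) (x₂ , _) with ℤₚ.≤-total x₁ x₂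
... | inj₁ x₁≤x₂ = geodesic-rightward x₁≤x₂
... | inj₂ x₂≤x₁ = geodesic-reverse (geodesic-rightward x₂≤x₁)

edges : ∀ {a b k} → HexWalk a b k → List (Vtx × Vtx)
edges here               = []
edges (step {a} {b} _ w) = (a , b) ∷ edges w

vertices : ∀ {a b k} → HexWalk a b k → List Vtx
vertices (here {a})     = a ∷ []
vertices (step {a} _ w) = a ∷ vertices w

length-edges : ∀ {a b k} (w : HexWalk a b k) → length (edges w) ≡ k
length-edges here       = refl
length-edges (step _ w) = cong suc (length-edges w)

edges-adj : ∀ {a b k} (w : HexWalk a b k) → AllAdj (edges w)
edges-adj (step s _) (here refl) = s
edges-adj (step _ w) (there e∈)  = edges-adj w e∈

start∈ : ∀ {a b k} (w : HexWalk a b k) → a ∈ vertices w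
start∈ here       = here refl
start∈ (step _ _) = here refl

end∈ : ∀ {a b k} (w : HexWalk a b k) → b ∈ vertices w
end∈ here       = here refl
end∈ (step _ w) = there (end∈ w)

middle∈ : ∀ {a b c k l} (w : HexWalk a b k) (w′ : HexWalk b c l) → b ∈ vertices (w ++ʰ w′)
middle∈ here       w′ = start∈ w′
middle∈ (step _ w) w′ = there (middle∈ w w′)

source∈ : ∀ {a b k} (w : HexWalk a b k) {u v} → (u , v) ∈ edges w → u ∈ vertices w
source∈ (step _ _) (here refl) = here refl
source∈ (step _ w) (there e∈)  = there (source∈ w e∈)

target∈ : ∀ {a b k} (w : HexWalk a b k) {u v} → (u , v) ∈ edges w → v ∈ vertices w
target∈ (step _ w) (here refl) = there (start∈ w)
target∈ (step _ w) (there e∈)  = there (target∈ w e∈)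

reach : ∀ {a b k} (w : HexWalk a b k) {v} → v ∈ vertices w → EWalk (edges w) a v
reach here       (here refl) = here
reach (step _ _) (here refl) = here
reach (step _ w) (there v∈)  = step (inj₁ (here refl)) (mapᵉ there (reach w v∈))

∈-removeAt⁻ : ∀ {A : Set} {x : A} xs (i : Fin (length xs)) → x ∈ xs →
              x ≡ lookup xs i ⊎ x ∈ removeAt xs i
∈-removeAt⁻ (_ ∷ _)  Fin.zero    (here eq)  = inj₁ eq
∈-removeAt⁻ (_ ∷ _)  Fin.zero    (there x∈) = inj₂ x∈
∈-removeAt⁻ (_ ∷ _)  (Fin.suc i) (here eq)  = inj₂ (here eq)
∈-removeAt⁻ (_ ∷ xs) (Fin.suc i) (there x∈) = Sum.map₂ there (∈-removeAt⁻ xs i x∈)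

removeAt⊆ : ∀ {A : Set} {x : A} xs (i : Fin (length xs)) → x ∈ removeAt xs i → x ∈ xs
removeAt⊆ (_ ∷ _)  Fin.zero    x∈         = there x∈
removeAt⊆ (_ ∷ _)  (Fin.suc i) (here eq)  = here eq
removeAt⊆ (_ ∷ xs) (Fin.suc i) (there x∈) = there (removeAt⊆ xs i x∈)

bypass : ∀ F (i : Fin (length F)) →
         EWalk (removeAt F i) (proj₁ (lookup F i)) (proj₂ (lookup F i)) →
         ∀ {u w} → EWalk F u w → EWalk (removeAt F i) u w
bypass F i detour here = here
bypass F i detour (step (inj₁ e∈) w) with ∈-removeAt⁻ F i e∈
... | inj₁ refl = detour ++ᵉ bypass F i detour w
... | inj₂ e∈′  = step (inj₁ e∈′) (bypass F i detour w)
bypass F i detour (step (inj₂ e∈) w) with ∈-removeAt⁻ F i e∈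
... | inj₁ refl = reverseᵉ detour ++ᵉ bypass F i detour w
... | inj₂ e∈′  = step (inj₂ e∈′) (bypass F i detour w)

-- Deleting an edge that is not a bridge would leave a and b connected by k - 1 edges,
-- too few by coordDist≤2*length.
short-walk-tree : ∀ {a b k} (w : HexWalk a b k) → 2 ℕ.* k ℕ.≤ coordDist a b →
                  IsHexTree (vertices w) (edges w)
short-walk-tree {a} {b} {k} w short = record
  { edgesAdj   = edges-adj w
  ; endpointsˡ = source∈ w
  ; endpointsʳ = target∈ w
  ; connected  = λ u∈ v∈ → reverseᵉ (reach w u∈) ++ᵉ reach w v∈
  ; acyclic    = acyclic
  }
  where
  acyclic : ∀ i → ¬ EWalk (removeAt (edges w) i) (proj₁ (lookup (edges w) i))
                                                 (proj₂ (lookup (edges w) i))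
  acyclic i detour = ℕₚ.<-irrefl refl (ℕₚ.≤-<-trans remaining (ℕₚ.<-≤-trans fewer short))
    where
    remaining : coordDist a b ℕ.≤ 2 ℕ.* length (removeAt (edges w) i)
    remaining = coordDist≤2*length (λ e∈ → edges-adj w (removeAt⊆ (edges w) i e∈))
                                   (bypass (edges w) i detour (reach w (end∈ w)))
    fewer : 2 ℕ.* length (removeAt (edges w) i) ℕ.< 2 ℕ.* k
    fewer = ℕₚ.*-monoʳ-< 2 (subst (length (removeAt (edges w) i) ℕ.<_)
              (trans (sym (Listₚ.length-removeAt′ (edges w) i)) (length-edges w)) (ℕₚ.n<1+n _))

hexWalk-coordDist≤ : ∀ {u w k} → HexWalk u w k → coordDist u w ℕ.≤ 2 ℕ.* k
hexWalk-coordDist≤ {u} {w} walk = subst (λ k → coordDist u w ℕ.≤ 2 ℕ.* k) (length-edges walk)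
                             (coordDist≤2*length (edges-adj walk) (reach walk (end∈ walk)))

hexDist-coordDist : ∀ {u w n} → HexDist u w n → 2 ℕ.* n ≡ coordDist u w
hexDist-coordDist {u} {w} (walk , shortest) with geodesic u w
... | k , geo , 2k≡d = ℕₚ.≤-antisym
  (ℕₚ.≤-trans (ℕₚ.*-monoʳ-≤ 2 (shortest k geo)) (ℕₚ.≤-reflexive 2k≡d))
  (hexWalk-coordDist≤ walk)

steiner-coordDist≤ : ∀ {v₁ v₂ v₃ m} → SteinerTree v₁ v₂ v₃ m → coordDist v₁ v₂ ℕ.≤ 2 ℕ.* m
steiner-coordDist≤ (_ , _ , tree , v₁∈ , v₂∈ , _ , refl) =
  coordDist≤2*length edgesAdj (connected v₁∈ v₂∈)
  where open IsHexTree tree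

steiner-coordDist< : ∀ {v₁ v₂ v₃ m} α → SteinerTree v₁ v₂ v₃ m → ¬ BetweenOn α v₁ v₂ v₃ →
                     coordDist v₁ v₂ ℕ.< 2 ℕ.* m
steiner-coordDist< α (_ , _ , tree , v₁∈ , v₂∈ , v₃∈ , refl) =
  coordDist<2*length α edgesAdj (connected v₁∈ v₂∈) (connected v₁∈ v₃∈) (connected v₂∈ v₃∈)
  where open IsHexTree tree

steiner-through : ∀ {v₁ v₂ v₃} → (∀ α → BetweenOn α v₁ v₂ v₃) →
                  Σ ℕ λ k → SteinerTree v₁ v₂ v₃ k × 2 ℕ.* k ≡ coordDist v₁ v₂
steiner-through {v₁} {v₂} {v₃} between with geodesic v₁ v₃ | geodesic v₃ v₂
... | k₁ , w₁ , 2k₁≡d | k₂ , w₂ , 2k₂≡d =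
  k₁ ℕ.+ k₂ ,
  (vertices w , edges w , short-walk-tree w (ℕₚ.≤-reflexive 2k≡d) ,
   start∈ w , end∈ w , middle∈ w₁ w₂ , length-edges w) ,
  2k≡d
  where
  w = w₁ ++ʰ w₂
  2k≡d : 2 ℕ.* (k₁ ℕ.+ k₂) ≡ coordDist v₁ v₂
  2k≡d = begin
    2 ℕ.* (k₁ ℕ.+ k₂)                    ≡⟨ ℕₚ.*-distribˡ-+ 2 k₁ k₂ ⟩
    2 ℕ.* k₁ ℕ.+ 2 ℕ.* k₂                ≡⟨ cong₂ ℕ._+_ 2k₁≡d 2k₂≡d ⟩
    coordDist v₁ v₃ ℕ.+ coordDist v₃ v₂  ≡⟨ coordDist-between between ⟩
    coordDist v₁ v₂                      ∎
    where open ≡-Reasoning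

lemma23 : (x₁ y₁ x₂ y₂ x y : ℤ) → (x₁ , y₁) ≢ (x₂ , y₂) →
          (n m : ℕ) → HexDist (x₁ , y₁) (x₂ , y₂) n →
          HexDist3 (x₁ , y₁) (x₂ , y₂) (x , y) m →
          (m ≡ n ⇔ (Between x₁ x₂ x × Between y₁ y₂ y × Between (x₁ - y₁) (x₂ - y₂) (x - y)))
lemma23 x₁ y₁ x₂ y₂ x y _ n m dist (tree , minimal) = mk⇔ to from
  where
  2n≡d : 2 ℕ.* n ≡ coordDist (x₁ , y₁) (x₂ , y₂)
  2n≡d = hexDist-coordDist dist
  to : m ≡ n → Between x₁ x₂ x × Between y₁ y₂ y × Between (x₁ - y₁) (x₂ - y₂) (x - y)
  to m≡n = between x-axis , between y-axis , between z-axis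
    where
    between : ∀ α → BetweenOn α (x₁ , y₁) (x₂ , y₂) (x , y)
    between α = decidable-stable (between? α _ _ _) λ outside → ℕₚ.<-irrefl (sym 2n≡d)
      (subst (λ k → coordDist (x₁ , y₁) (x₂ , y₂) ℕ.< 2 ℕ.* k) m≡n
             (steiner-coordDist< α tree outside))
  from : Between x₁ x₂ x × Between y₁ y₂ y × Between (x₁ - y₁) (x₂ - y₂) (x - y) → m ≡ n
  from (bx , by , bz) with steiner-through (λ { x-axis → bx ; y-axis → by ; z-axis → bz })
  ... | k , tree′ , 2k≡d = ℕₚ.≤-antisym
    (ℕₚ.*-cancelˡ-≤ 2 (ℕₚ.≤-trans (ℕₚ.*-monoʳ-≤ 2 (minimal k tree′))
                                  (ℕₚ.≤-reflexive (trans 2k≡d (sym 2n≡d)))))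
    (ℕₚ.*-cancelˡ-≤ 2 (subst (ℕ._≤ 2 ℕ.* m) (sym 2n≡d) (steiner-coordDist≤ tree)))
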